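{- (a) If $m, n$ are integers with $1 < m < n$, then \[ \sum_{d=1}^{n+1} \mu(d)\, 2^{\lfloor (n+1)/d\rfloor - \lfloor (n-1)/d\rfloor + \lfloor m/d\rfloor - \lfloor (m-1)/d\rfloor} = \begin{cases} 2 + M(n+1), & \text{if } (m,n)>1 \text{ and } (m,n+1)>1,\\ 3 + M(n+1), & \text{if } (m,n)=1 \text{ and } (m,n+1)>1, \text{ or } (m,n)>1 \text{ and } (m,n+1)=1,\\ 4 + M(n+1), & \text{if } (m,n)=(m,n+1)=1.\end{cases} \] (b) If $m, n$ are integers with $1 < n < m-1$, then \[ \sum_{d=1}^{m} \mu(d)\, 2^{\lfloor (n+1)/d\rfloor - \lfloor (n-1)/d\rfloor + \lfloor m/d\rfloor - \lfloor (m-1)/d\rfloor} = \begin{cases} 2 + M(m), & \text{if } (m,n)>1 \text{ and } (m,n+1)>1,\\ 3 + M(m), & \text{if } (m,n)=1 \text{ and } (m,n+1)>1, \text{ or } (m,n)>1 \text{ and } (m,n+1)=1,\\ 4 + M(m), & \text{if } (m,n)=(m,n+1)=1.\end{cases} \]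
   Context: $\mu$ is the Möbius function, $\lfloor x\rfloor$ is the floor of $x$, $(a,b)$ denotes $\gcd(a,b)$, and $M(n) = \sum_{d=1}^n \mu(d)$ is the Mertens function. -}

module Defs where

open import Data.Nat as ℕ using (ℕ; zero; suc; _∸_; _^_)
open import Data.Nat.DivMod using (_/_; _%_)
open import Data.Integer as ℤ using (ℤ; +_; -_; _+_)
open import Data.Bool using (Bool; true; false; if_then_else_)
open import Data.Nat using (_≡ᵇ_)

-- Möbius function, computed by trial division.
-- smallest divisor d ≥ k of n (n ≥ 2), searching k, k+1, ... (fuel bounded);
-- for n ≥ 2 with fuel ≥ n this returns the least prime factor of n.
leastDivFrom : ℕ → ℕ → ℕ → ℕ
leastDivFrom zero    k n = n
leastDivFrom (suc f) zero n = leastDivFrom f 2 n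
leastDivFrom (suc f) (suc j) n =
  if (n % suc j) ≡ᵇ 0 then suc j else leastDivFrom f (suc (suc j)) n

lpf : ℕ → ℕ
lpf n = leastDivFrom n 2 n

-- μ with fuel: μ(0) = 0 (convention, never used), μ(1) = 1,
-- for n ≥ 2 with least prime p: μ(n) = 0 if p² ∣ n, else -μ(n/p).
μ′ : ℕ → ℕ → ℤ
μ′ zero    n = + 0
μ′ (suc f) zero = + 0
μ′ (suc f) (suc zero) = + 1
μ′ (suc f) n@(suc (suc k)) with lpf n
... | zero = + 0
... | p@(suc p′) =
  if (n % (p ℕ.* p)) ≡ᵇ 0 then + 0 else - μ′ f (n / p)

μ : ℕ → ℤ
μ n = μ′ n n

sumFrom1 : ℕ → (ℕ → ℤ) → ℤ
sumFrom1 zero    f = + 0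
sumFrom1 (suc n) f = sumFrom1 n f + f (suc n)

M : ℕ → ℤ
M n = sumFrom1 n μ

-- exponent ⌊(n+1)/d⌋ - ⌊(n-1)/d⌋ + ⌊m/d⌋ - ⌊(m-1)/d⌋ (each difference ≥ 0 since floor is monotone)
expo : ℕ → ℕ → ℕ → ℕ
expo m n zero = 0
expo m n d@(suc _) = ((suc n / d) ∸ ((n ∸ 1) / d)) ℕ.+ ((m / d) ∸ ((m ∸ 1) / d))

S : ℕ → ℕ → ℕ → ℤ
S N m n = sumFrom1 N (λ d → μ d ℤ.* + (2 ^ expo m n d))

-- For d ≥ 1 the exponent is [d ∣ n + 1] + [d ∣ n] + [d ∣ m], and for bits a, b, c we have
-- 2^(a+b+c) = (1+a)(1+b)(1+c); hence 2^exponent = Σ_T [d ∣ gcd T] over the eight subsets T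
-- of {n + 1, n, m}, with gcd ∅ = 0. Exchanging the sums, S = Σ_T Σ_{d ≤ N, d ∣ gcd T} μ(d).
-- The empty subset contributes M(N); for every other T we have 1 ≤ gcd T ≤ N, so its inner
-- sum is Σ_{d ∣ g} μ(d) = [g = 1]. Here {n + 1, n} and {n + 1, n, m} have gcd 1, the
-- singletons have gcd > 1, and {m, n}, {m, n + 1} contribute [(m, n) = 1] + [(m, n + 1) = 1].
-- The vanishing of Σ_{d ∣ k} μ(d) for k > 1 comes from the recursive definition of μ through
-- the least prime factor p of k = p q: μ(p e) is -μ(e) if p ∤ e and 0 if p ∣ e.

{-# OPTIONS --safe #-}
module Submission where

open import Defs
open import Data.Nat using (ℕ; suc; _<_; _>_)
open import Data.Nat.GCD using (gcd)
open import Data.Integer using (+_; _+_)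
open import Data.Product using (_×_)
open import Data.Sum using (_⊎_)
open import Relation.Binary.PropositionalEquality using (_≡_)

open import Data.Bool.Base using (Bool; true; false; _∧_; if_then_else_)
open import Data.Integer.Base using (ℤ; -_; _*_)
open import Data.Integer.Properties
  using (*-identityʳ; *-zeroʳ; *-distribˡ-+; +-identityˡ; +-identityʳ; +-inverseˡ; neg-distrib-+)
open import Data.Integer.Tactic.RingSolver using (solve-∀)
open import Data.List.Base using (List; []; _∷_; foldr; map)
open import Data.Nat.Base as ℕ using (zero; _≤_; _∸_; _^_; z≤n; s≤s; NonZero; 2+)
import Data.Nat.Properties as ℕ
open import Data.Nat.DivMod
  using (_/_; _%_; m≡m%n+[m/n]*n; m%n<n; m*n/n≡m; m*[n/m]≡n; m/n<m; m<n⇒m/n≡0; +-distrib-/-∣ʳ; 0/n≡0)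
open import Data.Nat.Divisibility
  using (_∣_; _∤_; divides; _∣?_; ∣-refl; ∣-trans; ∣⇒≤; 1∣_; m∣m*n; n∣m*n; ∣m+n∣m⇒∣n;
         *-monoʳ-∣; *-cancelˡ-∣; hasNonTrivialDivisor)
open import Data.Nat.GCD using (gcd[m,n]∣m; gcd[m,n]∣n; gcd-greatest)
open import Data.Nat.Coprimality using (Coprime; coprime-divisor) renaming (sym to coprime-sym)
open import Data.Nat.Primality
  using (Prime; _Rough_; 2-rough; ∤⇒rough-suc; rough∧∣⇒rough; rough∧∣⇒prime; prime⇒irreducible)
open import Data.Product using (_,_; proj₁; uncurry)
open import Data.Sum using (inj₁; inj₂)
open import Function.Bundles using (_⇔_; mk⇔)
open import Relation.Nullary.Decidable using (Dec; yes; no; does; _×-dec_; dec-true; dec-false; does-⇔)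
open import Relation.Nullary.Negation using (¬_; contradiction)
open import Relation.Binary.PropositionalEquality
  using (refl; sym; trans; cong; cong₂; subst; module ≡-Reasoning)

open ≡-Reasoning

bit : Bool → ℕ
bit b = if b then 1 else 0

sum : List ℤ → ℤ
sum = foldr _+_ (+ 0)

sumFrom1-cong : ∀ N {f g : ℕ → ℤ} → (∀ d → f (suc d) ≡ g (suc d)) → sumFrom1 N f ≡ sumFrom1 N g
sumFrom1-cong zero    f≗g = refl
sumFrom1-cong (suc N) f≗g = cong₂ _+_ (sumFrom1-cong N f≗g) (f≗g N)

sumFrom1-zero : ∀ N → sumFrom1 N (λ _ → + 0) ≡ + 0
sumFrom1-zero zero    = refl
sumFrom1-zero (suc N) = trans (+-identityʳ _) (sumFrom1-zero N)

sumFrom1-+ : ∀ N (f g : ℕ → ℤ) → sumFrom1 N (λ d → f d + g d) ≡ sumFrom1 N f + sumFrom1 N g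
sumFrom1-+ zero    f g = refl
sumFrom1-+ (suc N) f g = trans (cong (_+ (f (suc N) + g (suc N))) (sumFrom1-+ N f g))
  (interchange (sumFrom1 N f) (sumFrom1 N g) (f (suc N)) (g (suc N)))
  where
  interchange : ∀ a b c d → a + b + (c + d) ≡ a + c + (b + d)
  interchange = solve-∀

sumFrom1-neg : ∀ N (f : ℕ → ℤ) → sumFrom1 N (λ d → - f d) ≡ - sumFrom1 N f
sumFrom1-neg zero    f = refl
sumFrom1-neg (suc N) f =
  trans (cong (_+ - f (suc N)) (sumFrom1-neg N f)) (sym (neg-distrib-+ (sumFrom1 N f) (f (suc N))))

sumFrom1-truncate : ∀ {K N} (f : ℕ → ℤ) → K ≤ N → (∀ d → K < d → f d ≡ + 0) →
                    sumFrom1 N f ≡ sumFrom1 K f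
sumFrom1-truncate {N = zero} f z≤n vanish = refl
sumFrom1-truncate {K} {suc N} f K≤1+N vanish with ℕ.m≤n⇒m<n∨m≡n K≤1+N
... | inj₂ refl  = refl
... | inj₁ K<1+N = begin
  sumFrom1 N f + f (suc N)
    ≡⟨ cong₂ _+_ (sumFrom1-truncate f (ℕ.m<1+n⇒m≤n K<1+N) vanish) (vanish (suc N) K<1+N) ⟩
  sumFrom1 K f + + 0
    ≡⟨ +-identityʳ _ ⟩
  sumFrom1 K f ∎

sumFrom1-sum : ∀ N (f : ℕ → ℕ → ℤ) gs →
  sumFrom1 N (λ d → sum (map (f d) gs)) ≡ sum (map (λ g → sumFrom1 N (λ d → f d g)) gs)
sumFrom1-sum N f []       = sumFrom1-zero N
sumFrom1-sum N f (g ∷ gs) =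
  trans (sumFrom1-+ N _ _) (cong (_+_ (sumFrom1 N (λ d → f d g))) (sumFrom1-sum N f gs))

*-sum-bits : ∀ x bs → x * sum (map (λ b → + bit b) bs) ≡ sum (map (λ b → if b then x else + 0) bs)
*-sum-bits x []       = *-zeroʳ x
*-sum-bits x (b ∷ bs) = trans (*-distribˡ-+ x (+ bit b) _) (cong₂ _+_ (*-bit b) (*-sum-bits x bs))
  where
  *-bit : ∀ b → x * + bit b ≡ (if b then x else + 0)
  *-bit true  = *-identityʳ x
  *-bit false = *-zeroʳ x

if-split : ∀ b (x : ℤ) → x ≡ (if b then x else + 0) + (if b then + 0 else x)
if-split true  x = sym (+-identityʳ x)
if-split false x = sym (+-identityˡ x)

[r+q*d]/d≡q : ∀ {r} q d .{{_ : NonZero d}} → r < d → (r ℕ.+ q ℕ.* d) / d ≡ q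
[r+q*d]/d≡q q d r<d = trans (+-distrib-/-∣ʳ _ (n∣m*n q)) (cong₂ ℕ._+_ (m<n⇒m/n≡0 r<d) (m*n/n≡m q d))

-- Writing a = r + q d with r < d, the divisibility d ∣ a + 1 is decided by whether r + 1 = d.
suc-/ : ∀ a d .{{_ : NonZero d}} → suc a / d ≡ bit (does (d ∣? suc a)) ℕ.+ a / d
suc-/ a d with ℕ.m≤n⇒m<n∨m≡n (m%n<n a d)
... | inj₁ 1+r<d = begin
  suc a / d                          ≡⟨ cong (λ x → suc x / d) (m≡m%n+[m/n]*n a d) ⟩
  (suc (a % d) ℕ.+ a / d ℕ.* d) / d  ≡⟨ [r+q*d]/d≡q (a / d) d 1+r<d ⟩
  a / d                              ≡⟨ cong (λ b → bit b ℕ.+ a / d) (dec-false (d ∣? suc a) d∤1+a) ⟨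
  bit (does (d ∣? suc a)) ℕ.+ a / d  ∎
  where
  d∤1+a : d ∤ suc a
  d∤1+a d∣1+a = ℕ.<⇒≱ 1+r<d (∣⇒≤ (∣m+n∣m⇒∣n d∣q*d+1+r (n∣m*n (a / d))))
    where
    d∣q*d+1+r : d ∣ a / d ℕ.* d ℕ.+ suc (a % d)
    d∣q*d+1+r = subst (d ∣_) (trans (cong suc (m≡m%n+[m/n]*n a d)) (ℕ.+-comm (suc (a % d)) _)) d∣1+a
... | inj₂ 1+r≡d = begin
  suc a / d                          ≡⟨ cong (_/ d) 1+a≡[1+q]*d ⟩
  suc (a / d) ℕ.* d / d              ≡⟨ m*n/n≡m (suc (a / d)) d ⟩
  suc (a / d)                        ≡⟨ cong (λ b → bit b ℕ.+ a / d) (dec-true (d ∣? suc a) d∣1+a) ⟨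
  bit (does (d ∣? suc a)) ℕ.+ a / d  ∎
  where
  1+a≡[1+q]*d : suc a ≡ suc (a / d) ℕ.* d
  1+a≡[1+q]*d = trans (cong suc (m≡m%n+[m/n]*n a d)) (cong (ℕ._+ a / d ℕ.* d) 1+r≡d)
  d∣1+a : d ∣ suc a
  d∣1+a = divides (suc (a / d)) 1+a≡[1+q]*d

suc-/-∸-/ : ∀ a d .{{_ : NonZero d}} → suc a / d ∸ a / d ≡ bit (does (d ∣? suc a))
suc-/-∸-/ a d = trans (cong (_∸ a / d) (suc-/ a d)) (ℕ.m+n∸n≡m _ (a / d))

expo-bits : ∀ m n d → let D = suc d in
  expo (suc m) (suc n) D ≡ bit (does (D ∣? 2+ n)) ℕ.+ bit (does (D ∣? suc n)) ℕ.+ bit (does (D ∣? suc m))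
expo-bits m n d = cong₂ ℕ._+_ two-steps (suc-/-∸-/ m D)
  where
  D : ℕ
  D = suc d
  two-steps : 2+ n / D ∸ n / D ≡ bit (does (D ∣? 2+ n)) ℕ.+ bit (does (D ∣? suc n))
  two-steps = begin
    2+ n / D ∸ n / D
      ≡⟨ cong (_∸ n / D) (trans (suc-/ (suc n) D) (cong (bit (does (D ∣? 2+ n)) ℕ.+_) (suc-/ n D))) ⟩
    bit (does (D ∣? 2+ n)) ℕ.+ (bit (does (D ∣? suc n)) ℕ.+ n / D) ∸ n / D
      ≡⟨ cong (_∸ n / D) (sym (ℕ.+-assoc (bit (does (D ∣? 2+ n))) _ _)) ⟩
    bit (does (D ∣? 2+ n)) ℕ.+ bit (does (D ∣? suc n)) ℕ.+ n / D ∸ n / D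
      ≡⟨ ℕ.m+n∸n≡m _ (n / D) ⟩
    bit (does (D ∣? 2+ n)) ℕ.+ bit (does (D ∣? suc n)) ∎

2^-bits : ∀ a b c →
  + (2 ^ (bit a ℕ.+ bit b ℕ.+ bit c))
    ≡ sum (map (λ x → + bit x) (true ∷ a ∷ b ∷ c ∷ a ∧ b ∷ c ∧ a ∷ c ∧ b ∷ a ∧ b ∧ c ∷ []))
2^-bits true  true  true  = refl
2^-bits true  true  false = refl
2^-bits true  false true  = refl
2^-bits true  false false = refl
2^-bits false true  true  = refl
2^-bits false true  false = refl
2^-bits false false true  = refl
2^-bits false false false = refl

∣gcd-does : ∀ d m n → does (d ∣? gcd m n) ≡ does (d ∣? m) ∧ does (d ∣? n)
∣gcd-does d m n = does-⇔ (mk⇔ divides-both (uncurry gcd-greatest)) (d ∣? gcd m n) ((d ∣? m) ×-dec (d ∣? n))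
  where
  divides-both : d ∣ gcd m n → d ∣ m × d ∣ n
  divides-both d∣g = ∣-trans d∣g (gcd[m,n]∣m m n) , ∣-trans d∣g (gcd[m,n]∣n m n)

∣suc∧∣⇒∣1 : ∀ {d n} → d ∣ suc n → d ∣ n → d ∣ 1
∣suc∧∣⇒∣1 {d} {n} d∣1+n = ∣m+n∣m⇒∣n (subst (d ∣_) (ℕ.+-comm 1 n) d∣1+n)

∣suc∧∣-does : ∀ d n → does (d ∣? suc n) ∧ does (d ∣? n) ≡ does (d ∣? 1)
∣suc∧∣-does d n =
  does-⇔ (mk⇔ (uncurry ∣suc∧∣⇒∣1) (λ d∣1 → ∣-trans d∣1 (1∣ _) , ∣-trans d∣1 (1∣ _)))
         ((d ∣? suc n) ×-dec (d ∣? n)) (d ∣? 1)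

∣suc∧∣∧∣-does : ∀ d m n → does (d ∣? suc n) ∧ does (d ∣? n) ∧ does (d ∣? m) ≡ does (d ∣? 1)
∣suc∧∣∧∣-does d m n =
  does-⇔ (mk⇔ (λ (d∣1+n , d∣n , _) → ∣suc∧∣⇒∣1 d∣1+n d∣n)
              (λ d∣1 → ∣-trans d∣1 (1∣ _) , ∣-trans d∣1 (1∣ _) , ∣-trans d∣1 (1∣ _)))
         ((d ∣? suc n) ×-dec ((d ∣? n) ×-dec (d ∣? m))) (d ∣? 1)

-- The gcds of the subsets of {n + 1, n, m}, in the order of 2^-bits; gcd ∅ = 0 and gcd (n + 1, n) = 1.
subsetGcds : ℕ → ℕ → List ℕ
subsetGcds m n = 0 ∷ suc n ∷ n ∷ m ∷ 1 ∷ gcd m (suc n) ∷ gcd m n ∷ 1 ∷ []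

μ*2^expo : ∀ m n d → let D = suc d in
  μ D * + (2 ^ expo (suc m) (suc n) D)
    ≡ sum (map (λ g → if does (D ∣? g) then μ D else + 0) (subsetGcds (suc m) (suc n)))
μ*2^expo m n d = begin
  μ D * + (2 ^ expo (suc m) (suc n) D)
    ≡⟨ cong (λ e → μ D * + (2 ^ e)) (expo-bits m n d) ⟩
  μ D * + (2 ^ (bit a ℕ.+ bit b ℕ.+ bit c))
    ≡⟨ cong (μ D *_) (2^-bits a b c) ⟩
  μ D * sum (map (λ x → + bit x) (true ∷ a ∷ b ∷ c ∷ a ∧ b ∷ c ∧ a ∷ c ∧ b ∷ a ∧ b ∧ c ∷ []))
    ≡⟨ cong (λ bs → μ D * sum (map (λ x → + bit x) bs)) subset-bits ⟩
  μ D * sum (map (λ x → + bit x) (map (λ g → does (D ∣? g)) (subsetGcds (suc m) (suc n))))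
    ≡⟨ *-sum-bits (μ D) (map (λ g → does (D ∣? g)) (subsetGcds (suc m) (suc n))) ⟩
  sum (map (λ x → if x then μ D else + 0) (map (λ g → does (D ∣? g)) (subsetGcds (suc m) (suc n)))) ∎
  where
  D : ℕ
  D = suc d
  a b c : Bool
  a = does (D ∣? 2+ n)
  b = does (D ∣? suc n)
  c = does (D ∣? suc m)
  subset-bits : true ∷ a ∷ b ∷ c ∷ a ∧ b ∷ c ∧ a ∷ c ∧ b ∷ a ∧ b ∧ c ∷ []
              ≡ true ∷ a ∷ b ∷ c ∷ does (D ∣? 1) ∷ does (D ∣? gcd (suc m) (2+ n))
                ∷ does (D ∣? gcd (suc m) (suc n)) ∷ does (D ∣? 1) ∷ []
  subset-bits rewrite ∣suc∧∣-does D (suc n) | ∣suc∧∣∧∣-does D (suc m) (suc n)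
                    | ∣gcd-does D (suc m) (2+ n) | ∣gcd-does D (suc m) (suc n) = refl

LeastDivisor : ℕ → ℕ → Set
LeastDivisor n p = 1 < p × p ∣ n × p Rough n

leastDivisor-unique : ∀ {n p r} → LeastDivisor n p → LeastDivisor n r → p ≡ r
leastDivisor-unique (1<p , p∣n , p-rough) (1<r , r∣n , r-rough) =
  ℕ.≤-antisym (ℕ.≮⇒≥ (not-below p-rough 1<r r∣n)) (ℕ.≮⇒≥ (not-below r-rough 1<p p∣n))
  where
  not-below : ∀ {n p r} → r Rough n → 1 < p → p ∣ n → ¬ p < r
  not-below r-rough 1<p p∣n p<r = r-rough (hasNonTrivialDivisor ⦃ ℕ.n>1⇒nonTrivial 1<p ⦄ p<r p∣n)

leastDivFrom-least : ∀ f k {n} → 1 < k → k Rough n → n ≤ f ℕ.+ k → 1 < n →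
                     LeastDivisor n (leastDivFrom f k n)
leastDivFrom-least zero    k {n} 1<k k-rough n≤k 1<n = 1<n , ∣-refl , n-rough
  where
  n-rough : n Rough n
  n-rough (hasNonTrivialDivisor d<n d∣n) = k-rough (hasNonTrivialDivisor (ℕ.<-≤-trans d<n n≤k) d∣n)
leastDivFrom-least (suc f) (suc j) {n} 1<k k-rough n≤1+f+k 1<n = step (suc j ∣? n)
  where
  step : (k∣?n : Dec (suc j ∣ n)) → LeastDivisor n (if does k∣?n then suc j else leastDivFrom f (2+ j) n)
  step (yes k∣n) = 1<k , k∣n , k-rough
  step (no k∤n)  = leastDivFrom-least f (2+ j) (ℕ.m<n⇒m<1+n 1<k) (∤⇒rough-suc k∤n k-rough)
                     (subst (n ≤_) (sym (ℕ.+-suc f (suc j))) n≤1+f+k) 1<n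

lpf-least : ∀ {n} → 1 < n → LeastDivisor n (lpf n)
lpf-least {n} = leastDivFrom-least n 2 (s≤s (s≤s z≤n)) 2-rough (ℕ.m≤m+n n 2)

lpf-unique : ∀ {n p} → 1 < n → LeastDivisor n p → lpf n ≡ p
lpf-unique 1<n = leastDivisor-unique (lpf-least 1<n)

μ′-fuel : ∀ {f g} x → x ≤ f → x ≤ g → μ′ f x ≡ μ′ g x
μ′-fuel {zero}  {zero}  zero _ _ = refl
μ′-fuel {zero}  {suc _} zero _ _ = refl
μ′-fuel {suc _} {zero}  zero _ _ = refl
μ′-fuel {suc _} {suc _} zero _ _ = refl
μ′-fuel {suc _} {suc _} 1    _ _ = refl
μ′-fuel {suc f} {suc g} x@(2+ k) (s≤s k<f) (s≤s k<g) with lpf x | proj₁ (lpf-least {x} (s≤s (s≤s z≤n)))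
... | suc p | 1<p = cong (λ y → if does (suc p ℕ.* suc p ∣? x) then + 0 else - y)
                         (μ′-fuel (x / suc p) (ℕ.≤-trans x/p≤1+k k<f) (ℕ.≤-trans x/p≤1+k k<g))
  where
  x/p≤1+k : x / suc p ≤ suc k
  x/p≤1+k = ℕ.≤-pred (m/n<m x (suc p) 1<p)

μ-unfold : ∀ {x p} → 1 < x → lpf x ≡ suc p →
           μ x ≡ (if does (suc p ℕ.* suc p ∣? x) then + 0 else - μ (x / suc p))
μ-unfold {1} (s≤s ()) _
μ-unfold {x@(2+ k)} {p} _ lpf≡1+p with lpf x | lpf≡1+p | proj₁ (lpf-least {x} (s≤s (s≤s z≤n)))
... | .(suc p) | refl | 1<p = cong (λ y → if does (suc p ℕ.* suc p ∣? x) then + 0 else - y)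
                                   (μ′-fuel (x / suc p) (ℕ.≤-pred (m/n<m x (suc p) 1<p)) ℕ.≤-refl)

*-cancelˡ-∣-⇔ : ∀ p .{{_ : NonZero p}} {m n} → p ℕ.* m ∣ p ℕ.* n ⇔ m ∣ n
*-cancelˡ-∣-⇔ p = mk⇔ (*-cancelˡ-∣ p) (*-monoʳ-∣ p)

μ-multiple : ∀ {p e} .{{_ : NonZero e}} → 1 < p → p Rough (p ℕ.* e) →
  μ (p ℕ.* e) ≡ (if does (p ∣? e) then + 0 else - μ e)
μ-multiple {p@(suc _)} {e} 1<p p-rough = begin
  μ (p ℕ.* e)
    ≡⟨ μ-unfold 1<p*e (lpf-unique 1<p*e (1<p , m∣m*n e , p-rough)) ⟩
  (if does (p ℕ.* p ∣? p ℕ.* e) then + 0 else - μ (p ℕ.* e / p))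
    ≡⟨ cong₂ (λ b y → if b then + 0 else - μ y)
             (does-⇔ (*-cancelˡ-∣-⇔ p) (p ℕ.* p ∣? p ℕ.* e) (p ∣? e)) p*e/p≡e ⟩
  (if does (p ∣? e) then + 0 else - μ e) ∎
  where
  1<p*e : 1 < p ℕ.* e
  1<p*e = ℕ.<-≤-trans 1<p (ℕ.m≤m*n p e)
  p*e/p≡e : p ℕ.* e / p ≡ e
  p*e/p≡e = trans (cong (_/ p) (ℕ.*-comm p e)) (m*n/n≡m e p)

μ-multiple-∣ : ∀ {p e} .{{_ : NonZero e}} → 1 < p → p Rough (p ℕ.* e) → p ∣ e → μ (p ℕ.* e) ≡ + 0
μ-multiple-∣ 1<p p-rough p∣e =
  trans (μ-multiple 1<p p-rough) (cong (λ b → if b then _ else _) (dec-true (_ ∣? _) p∣e))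

μ-multiple-∤ : ∀ {p e} .{{_ : NonZero e}} → 1 < p → p Rough (p ℕ.* e) → p ∤ e → μ (p ℕ.* e) ≡ - μ e
μ-multiple-∤ 1<p p-rough p∤e =
  trans (μ-multiple 1<p p-rough) (cong (λ b → if b then _ else _) (dec-false (_ ∣? _) p∤e))

prime∤⇒coprime : ∀ {p n} → Prime p → p ∤ n → Coprime p n
prime∤⇒coprime p-prime p∤n (d∣p , d∣n) with prime⇒irreducible p-prime d∣p
... | inj₁ d≡1 = d≡1
... | inj₂ refl = contradiction d∣n p∤n

prime∤∧∣*⇒∣ : ∀ {p d q} → Prime p → p ∤ d → d ∣ p ℕ.* q → d ∣ q
prime∤∧∣*⇒∣ p-prime p∤d = coprime-divisor (coprime-sym (prime∤⇒coprime p-prime p∤d))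

sumFrom1-multiples : ∀ p .{{_ : NonZero p}} N (f : ℕ → ℤ) →
  sumFrom1 N (λ d → if does (p ∣? d) then f d else + 0) ≡ sumFrom1 (N / p) (λ e → f (p ℕ.* e))
sumFrom1-multiples p zero    f = cong (λ K → sumFrom1 K (λ e → f (p ℕ.* e))) (sym (0/n≡0 p))
sumFrom1-multiples p (suc N) f with p ∣? suc N | suc-/ N p
... | yes p∣1+N | [1+N]/p≡1+N/p rewrite [1+N]/p≡1+N/p =
  cong₂ _+_ (sumFrom1-multiples p N f) (cong f (sym p*[1+N/p]≡1+N))
  where
  p*[1+N/p]≡1+N : p ℕ.* suc (N / p) ≡ suc N
  p*[1+N/p]≡1+N = trans (cong (p ℕ.*_) (sym [1+N]/p≡1+N/p)) (m*[n/m]≡n p∣1+N)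
... | no _      | [1+N]/p≡N/p = begin
  sumFrom1 N (λ d → if does (p ∣? d) then f d else + 0) + + 0  ≡⟨ +-identityʳ _ ⟩
  sumFrom1 N (λ d → if does (p ∣? d) then f d else + 0)        ≡⟨ sumFrom1-multiples p N f ⟩
  sumFrom1 (N / p) (λ e → f (p ℕ.* e))
    ≡⟨ cong (λ K → sumFrom1 K (λ e → f (p ℕ.* e))) [1+N]/p≡N/p ⟨
  sumFrom1 (suc N / p) (λ e → f (p ℕ.* e))                     ∎

μ-divisorSum : ℕ → ℕ → ℤ
μ-divisorSum N k = sumFrom1 N (λ d → if does (d ∣? k) then μ d else + 0)

μ-divisorSum-0 : ∀ N → μ-divisorSum N 0 ≡ M N
μ-divisorSum-0 N = sumFrom1-cong N (λ _ → refl)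

μ-divisorSum-truncate : ∀ {N k} .{{_ : NonZero k}} → k ≤ N → μ-divisorSum N k ≡ μ-divisorSum k k
μ-divisorSum-truncate {N} {k} k≤N = sumFrom1-truncate _ k≤N vanish
  where
  vanish : ∀ d → k < d → (if does (d ∣? k) then μ d else + 0) ≡ + 0
  vanish d k<d rewrite dec-false (d ∣? k) (λ d∣k → ℕ.<⇒≱ k<d (∣⇒≤ d∣k)) = refl

-- The divisors p e of p q cancel against the divisors e coprime to p, since μ(p e) = -μ(e).
μ-divisorSum-rough : ∀ p q .{{_ : NonZero q}} → 1 < p → p Rough (p ℕ.* q) →
                     μ-divisorSum (p ℕ.* q) (p ℕ.* q) ≡ + 0
μ-divisorSum-rough p q 1<p p-rough = begin
  sumFrom1 k f
    ≡⟨ sumFrom1-cong k (λ d → if-split (does (p ∣? suc d)) (f (suc d))) ⟩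
  sumFrom1 k (λ d → (if does (p ∣? d) then f d else + 0) + (if does (p ∣? d) then + 0 else f d))
    ≡⟨ sumFrom1-+ k _ _ ⟩
  sumFrom1 k (λ d → if does (p ∣? d) then f d else + 0) + sumFrom1 k (λ d → if does (p ∣? d) then + 0 else f d)
    ≡⟨ cong₂ _+_ multiples-of-p others ⟩
  sumFrom1 q (λ e → - g e) + sumFrom1 q g
    ≡⟨ cong (_+ sumFrom1 q g) (sumFrom1-neg q g) ⟩
  - sumFrom1 q g + sumFrom1 q g
    ≡⟨ +-inverseˡ (sumFrom1 q g) ⟩
  + 0 ∎
  where
  instance
    p-nonZero : NonZero p
    p-nonZero = ℕ.>-nonZero (ℕ.<-trans (s≤s z≤n) 1<p)

  k : ℕ
  k = p ℕ.* q
  f g : ℕ → ℤ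
  f d = if does (d ∣? k) then μ d else + 0
  g d = if does (p ∣? d) then + 0 else (if does (d ∣? q) then μ d else + 0)

  p-prime : Prime p
  p-prime = rough∧∣⇒prime ⦃ ℕ.n>1⇒nonTrivial 1<p ⦄ p-rough (m∣m*n q)

  f[p*e]≡-g[e] : ∀ e .{{_ : NonZero e}} → (if does (p ℕ.* e ∣? k) then μ (p ℕ.* e) else + 0)
                     ≡ - (if does (p ∣? e) then + 0 else (if does (e ∣? q) then μ e else + 0))
  f[p*e]≡-g[e] e rewrite does-⇔ (*-cancelˡ-∣-⇔ p) (p ℕ.* e ∣? k) (e ∣? q) with e ∣? q | p ∣? e
  ... | no _     | yes _    = refl
  ... | no _     | no _     = refl
  ... | yes e∣q  | yes p∣e  = μ-multiple-∣ 1<p (rough∧∣⇒rough p-rough (*-monoʳ-∣ p e∣q)) p∣e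
  ... | yes e∣q  | no p∤e   = μ-multiple-∤ 1<p (rough∧∣⇒rough p-rough (*-monoʳ-∣ p e∣q)) p∤e

  multiples-of-p : sumFrom1 k (λ d → if does (p ∣? d) then f d else + 0) ≡ sumFrom1 q (λ e → - g e)
  multiples-of-p = begin
    sumFrom1 k (λ d → if does (p ∣? d) then f d else + 0)
      ≡⟨ sumFrom1-multiples p k f ⟩
    sumFrom1 (k / p) (λ e → f (p ℕ.* e))
      ≡⟨ cong (λ K → sumFrom1 K (λ e → f (p ℕ.* e))) k/p≡q ⟩
    sumFrom1 q (λ e → f (p ℕ.* e))
      ≡⟨ sumFrom1-cong q (λ e → f[p*e]≡-g[e] (suc e)) ⟩
    sumFrom1 q (λ e → - g e) ∎
    where
    k/p≡q : k / p ≡ q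
    k/p≡q = trans (cong (_/ p) (ℕ.*-comm p q)) (m*n/n≡m q p)

  f≡g-off-p : ∀ d → (if does (p ∣? d) then + 0 else f d) ≡ g d
  f≡g-off-p d with p ∣? d
  ... | yes _   = refl
  ... | no p∤d  = cong (λ b → if b then μ d else + 0) (does-⇔ d∣k⇔d∣q (d ∣? k) (d ∣? q))
    where
    d∣k⇔d∣q : d ∣ k ⇔ d ∣ q
    d∣k⇔d∣q = mk⇔ (prime∤∧∣*⇒∣ p-prime p∤d) (λ d∣q → ∣-trans d∣q (n∣m*n p))

  g-vanish : ∀ d → q < d → g d ≡ + 0
  g-vanish d q<d with p ∣? d
  ... | yes _ = refl
  ... | no _ rewrite dec-false (d ∣? q) (λ d∣q → ℕ.<⇒≱ q<d (∣⇒≤ d∣q)) = refl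

  others : sumFrom1 k (λ d → if does (p ∣? d) then + 0 else f d) ≡ sumFrom1 q g
  others = trans (sumFrom1-cong k (λ d → f≡g-off-p (suc d))) (sumFrom1-truncate g (ℕ.m≤n*m q p) g-vanish)

μ-divisorSum-self : ∀ {k} → 1 < k → μ-divisorSum k k ≡ + 0
μ-divisorSum-self {k} 1<k with lpf-least 1<k
... | _   , divides zero    k≡0     , _ = contradiction (subst (1 <_) k≡0 1<k) ℕ.n≮0
... | 1<p , divides (suc q) k≡q*p , p-rough =
  subst (λ n → μ-divisorSum n n ≡ + 0) (sym k≡p*q)
        (μ-divisorSum-rough (lpf k) (suc q) 1<p (subst (lpf k Rough_) k≡p*q p-rough))
  where
  k≡p*q : k ≡ lpf k ℕ.* suc q
  k≡p*q = trans k≡q*p (ℕ.*-comm (suc q) (lpf k))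

μ-divisorSum-nonTrivial : ∀ {N k} → 1 < k → k ≤ N → μ-divisorSum N k ≡ + 0
μ-divisorSum-nonTrivial {k = suc _} 1<k k≤N = trans (μ-divisorSum-truncate k≤N) (μ-divisorSum-self 1<k)

μ-divisorSum-1 : ∀ {N} → 1 ≤ N → μ-divisorSum N 1 ≡ + 1
μ-divisorSum-1 = μ-divisorSum-truncate

S≡μ-divisorSums : ∀ {N m n} → 1 < m → 1 < n → suc n ≤ N → m ≤ N →
  S N m n ≡ + 2 + μ-divisorSum N (gcd m n) + μ-divisorSum N (gcd m (suc n)) + M N
S≡μ-divisorSums {N} {m@(suc m′)} {n@(suc n′)} 1<m 1<n n<N m≤N = begin
  S N m n
    ≡⟨ sumFrom1-cong N (μ*2^expo m′ n′) ⟩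
  sumFrom1 N (λ d → sum (map (λ g → if does (d ∣? g) then μ d else + 0) (subsetGcds m n)))
    ≡⟨ sumFrom1-sum N (λ d g → if does (d ∣? g) then μ d else + 0) (subsetGcds m n) ⟩
  sum (map (μ-divisorSum N) (subsetGcds m n))
    ≡⟨ evaluate ⟩
  + 2 + μ-divisorSum N (gcd m n) + μ-divisorSum N (gcd m (suc n)) + M N ∎
  where
  collect : ∀ t c c′ → t + (+ 0 + (+ 0 + (+ 0 + (+ 1 + (c′ + (c + (+ 1 + + 0))))))) ≡ + 2 + c + c′ + t
  collect = solve-∀
  evaluate : μ-divisorSum N 0 + (μ-divisorSum N (suc n) + (μ-divisorSum N n + (μ-divisorSum N m
             + (μ-divisorSum N 1 + (μ-divisorSum N (gcd m (suc n)) + (μ-divisorSum N (gcd m n)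
             + (μ-divisorSum N 1 + + 0)))))))
           ≡ + 2 + μ-divisorSum N (gcd m n) + μ-divisorSum N (gcd m (suc n)) + M N
  evaluate rewrite μ-divisorSum-0 N
                 | μ-divisorSum-nonTrivial (ℕ.m<n⇒m<1+n 1<n) n<N
                 | μ-divisorSum-nonTrivial 1<n (ℕ.<⇒≤ n<N)
                 | μ-divisorSum-nonTrivial 1<m m≤N
                 | μ-divisorSum-1 (ℕ.≤-trans (ℕ.<⇒≤ 1<m) m≤N)
                 = collect (M N) (μ-divisorSum N (gcd m n)) (μ-divisorSum N (gcd m (suc n)))

SumCases : ℕ → ℕ → ℕ → Set
SumCases N m n =
    ((gcd m n > 1 × gcd m (suc n) > 1) → S N m n ≡ + 2 + M N)
  × (((gcd m n ≡ 1 × gcd m (suc n) > 1) ⊎ (gcd m n > 1 × gcd m (suc n) ≡ 1)) → S N m n ≡ + 3 + M N)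
  × ((gcd m n ≡ 1 × gcd m (suc n) ≡ 1) → S N m n ≡ + 4 + M N)

S-cases : ∀ {N m n} → 1 < m → 1 < n → suc n ≤ N → m ≤ N → SumCases N m n
S-cases {N} {m@(suc _)} {n} 1<m 1<n n<N m≤N =
    (λ (g₁ , g₂) → S-evaluate (term>1 n g₁) (term>1 (suc n) g₂))
  , (λ { (inj₁ (g₁ , g₂)) → S-evaluate (term≡1 n g₁) (term>1 (suc n) g₂)
       ; (inj₂ (g₁ , g₂)) → S-evaluate (term>1 n g₁) (term≡1 (suc n) g₂) })
  , (λ (g₁ , g₂) → S-evaluate (term≡1 n g₁) (term≡1 (suc n) g₂))
  where
  S-evaluate : ∀ {a b} → μ-divisorSum N (gcd m n) ≡ a → μ-divisorSum N (gcd m (suc n)) ≡ b →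
           S N m n ≡ + 2 + a + b + M N
  S-evaluate refl refl = S≡μ-divisorSums 1<m 1<n n<N m≤N
  term>1 : ∀ x → gcd m x > 1 → μ-divisorSum N (gcd m x) ≡ + 0
  term>1 x 1<g = μ-divisorSum-nonTrivial 1<g (ℕ.≤-trans (∣⇒≤ (gcd[m,n]∣m m x)) m≤N)
  term≡1 : ∀ x → gcd m x ≡ 1 → μ-divisorSum N (gcd m x) ≡ + 1
  term≡1 x g≡1 = trans (cong (μ-divisorSum N) g≡1) (μ-divisorSum-1 (ℕ.≤-trans (ℕ.<⇒≤ 1<m) m≤N))

theorem6 : (∀ (m n : ℕ) → 1 < m → m < n →
    ((gcd m n > 1 × gcd m (suc n) > 1) → S (suc n) m n ≡ + 2 + M (suc n))
    × (((gcd m n ≡ 1 × gcd m (suc n) > 1) ⊎ (gcd m n > 1 × gcd m (suc n) ≡ 1))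
    → S (suc n) m n ≡ + 3 + M (suc n))
    × ((gcd m n ≡ 1 × gcd m (suc n) ≡ 1) → S (suc n) m n ≡ + 4 + M (suc n)))
    × (∀ (m n : ℕ) → 1 < n → suc n < m →
    ((gcd m n > 1 × gcd m (suc n) > 1) → S m m n ≡ + 2 + M m)
    × (((gcd m n ≡ 1 × gcd m (suc n) > 1) ⊎ (gcd m n > 1 × gcd m (suc n) ≡ 1))
    → S m m n ≡ + 3 + M m)
    × ((gcd m n ≡ 1 × gcd m (suc n) ≡ 1) → S m m n ≡ + 4 + M m))
theorem6 =
    (λ m n 1<m m<n → S-cases 1<m (ℕ.<-trans 1<m m<n) ℕ.≤-refl (ℕ.m≤n⇒m≤1+n (ℕ.<⇒≤ m<n)))
  , (λ m n 1<n 1+n<m → S-cases (ℕ.<-trans 1<n (ℕ.<-trans (ℕ.n<1+n n) 1+n<m)) 1<n (ℕ.<⇒≤ 1+n<m) ℕ.≤-refl)
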